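{- Define $sf(n,3)$ for integers $n$ by $sf(n,3)=0$ for $n<0$, $sf(0,3)=1$, and for $n>0$: $sf(n,3)=sf(n/3,3)$ if $3\mid n$, and $sf(n,3)=sf(n-r,3)+sf(n-3,3)$ if $n\equiv r\pmod 3$ with $r\in\{1,2\}$. Then: (a) for every $j\ge0$, $\sum_{r=0}^{2j+1}sf(r,3)\equiv0\pmod 2$; (b) for every even $j\ge0$, $sf(3j+4,3)=sf(3j+5,3)\equiv0\pmod2$; (c) for all $j\ge0$ and $r\ge2$, $sf(3^rj+4,3)=sf(3^rj+5,3)\equiv0\pmod2$.
   Context: $sf(n,3)$ is the number of semi-$3$-Fibonacci partitions of $n$, characterized by the stated recurrence. -}

module Defs where

open import Data.Nat using (ℕ; zero; suc; _+_; _*_; _∸_; _/_; _%_; _<_; _≤_)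
open import Data.Nat.Properties using (_<?_)
open import Relation.Nullary using (yes; no)

-- sf(n,3) on integers: 0 for negative arguments, so we work on ℕ and
-- encode "sf(n-3,3) with n-3 < 0" as 0 explicitly.
-- Fuel-based recursion: every recursive call decreases the argument
-- (n/3 < n for n > 0, n - r < n, n - 3 < n), so fuel (suc n) suffices.
sfAux : ℕ → ℕ → ℕ
sfAux zero    _ = 0
sfAux (suc f) zero = 1
sfAux (suc f) (suc m) with (suc m) % 3
... | 0 = sfAux f ((suc m) / 3)
... | r = sfAux f (suc m ∸ r) + (if3 (suc m))
  where
  if3 : ℕ → ℕ
  if3 n with n <? 3
  ... | yes _ = 0
  ... | no  _ = sfAux f (n ∸ 3)

sf : ℕ → ℕ
sf n = sfAux (suc n) n

sumTo : (ℕ → ℕ) → ℕ → ℕ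
sumTo f zero    = f 0
sumTo f (suc k) = sumTo f k + f (suc k)

-- Unfolding the recurrence three steps at a time gives sf(3k+3) = sf(k+1),
-- sf(3k+4) = sf(3k+3) + sf(3k+1) and sf(3k+5) = sf(3k+3) + sf(3k+2); hence
-- sf(3k+1) = sf(3k+2), and telescoping yields sf(3k+1) = S(k), where S is the
-- partial sum S(n) = sf(0) + … + sf(n). Consequently S(3k+4) = S(3k+1) + 2 sf(3k+4),
-- so S(3k+1) is even, while S(3k) + S(k) = S(3k+1) and S(3k+2) = S(3k+1) + S(k).
-- Strong induction on odd n then shows that S(n) is even, which is (a); (b) and
-- (c) follow because sf(3k+4) = S(k+1) and k+1 is odd, resp. of the form 3m+1.
module Submission where

open import Defs
open import Data.Nat
open import Data.Nat.Properties
open import Data.Nat.DivMod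
open import Data.Nat.Divisibility
open import Data.Nat.Induction using (<-rec)
open import Data.Nat.Tactic.RingSolver using (solve-∀)
open import Data.Product using (_×_; _,_)
open import Relation.Nullary using (¬_; yes; no; contradiction)
open import Relation.Binary.PropositionalEquality

sfAux-suc-cong : ∀ {f g} n → (∀ k → k < n → sfAux f k ≡ sfAux g k) →
                 sfAux (suc f) n ≡ sfAux (suc g) n
sfAux-suc-cong zero    _     = refl
sfAux-suc-cong (suc m) below with suc m % 3
... | zero = below (suc m / 3) (m/n<m (suc m) 3 (s≤s (s≤s z≤n)))
... | suc r with suc m <? 3
...   | yes _ = cong (_+ 0) (below (m ∸ r) (s≤s (m∸n≤m m r)))
...   | no  _ = cong₂ _+_ (below (m ∸ r) (s≤s (m∸n≤m m r))) (below (m ∸ 2) (s≤s (m∸n≤m m 2)))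

sfAux-fuel-irrelevant : ∀ {f g} n → n < f → n < g → sfAux f n ≡ sfAux g n
sfAux-fuel-irrelevant {suc f} {suc g} n (s≤s n≤f) (s≤s n≤g) = sfAux-suc-cong n λ k k<n →
  sfAux-fuel-irrelevant k (<-≤-trans k<n n≤f) (<-≤-trans k<n n≤g)

sf-unfold-3∣ : ∀ n → suc n % 3 ≡ 0 → sf (suc n) ≡ sf (suc n / 3)
sf-unfold-3∣ n n%3≡0 rewrite n%3≡0 =
  sfAux-fuel-irrelevant (suc n / 3) (m/n<m (suc n) 3 (s≤s (s≤s z≤n))) ≤-refl

sf-unfold-3∤ : ∀ n r → suc n % 3 ≡ suc r → 3 ≤ suc n →
               sf (suc n) ≡ sf (suc n ∸ suc r) + sf (suc n ∸ 3)
sf-unfold-3∤ n r n%3≡r 3≤n rewrite n%3≡r with suc n <? 3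
... | yes n<3 = contradiction n<3 (≤⇒≯ 3≤n)
... | no  _   = cong₂ _+_
  (sfAux-fuel-irrelevant (n ∸ r) (s≤s (m∸n≤m n r)) ≤-refl)
  (sfAux-fuel-irrelevant (n ∸ 2) (s≤s (m∸n≤m n 2)) ≤-refl)

[r+3k]%3≡r%3 : ∀ r k → (r + 3 * k) % 3 ≡ r % 3
[r+3k]%3≡r%3 r k = trans (cong (λ x → (r + x) % 3) (*-comm 3 k)) ([m+kn]%n≡m%n r k 3)

sf-3k+3 : ∀ k → sf (3 + 3 * k) ≡ sf (1 + k)
sf-3k+3 k = begin
  sf (3 + 3 * k)       ≡⟨ sf-unfold-3∣ (2 + 3 * k) (trans (cong (_% 3) 3+3k≡) (m*n%n≡0 (suc k) 3)) ⟩
  sf ((3 + 3 * k) / 3) ≡⟨ cong sf (trans (cong (_/ 3) 3+3k≡) (m*n/n≡m (suc k) 3)) ⟩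
  sf (1 + k)           ∎
  where
  open ≡-Reasoning
  3+3k≡ : 3 + 3 * k ≡ suc k * 3
  3+3k≡ = trans (sym (*-suc 3 k)) (*-comm 3 (suc k))

sf-3k+4 : ∀ k → sf (4 + 3 * k) ≡ sf (3 + 3 * k) + sf (1 + 3 * k)
sf-3k+4 k = sf-unfold-3∤ (3 + 3 * k) 0 ([r+3k]%3≡r%3 4 k) (s≤s (s≤s (s≤s z≤n)))

sf-3k+5 : ∀ k → sf (5 + 3 * k) ≡ sf (3 + 3 * k) + sf (2 + 3 * k)
sf-3k+5 k = sf-unfold-3∤ (4 + 3 * k) 1 ([r+3k]%3≡r%3 5 k) (s≤s (s≤s (s≤s z≤n)))

sf-3k+1≡sf-3k+2 : ∀ k → sf (1 + 3 * k) ≡ sf (2 + 3 * k)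
sf-3k+1≡sf-3k+2 zero    = refl
sf-3k+1≡sf-3k+2 (suc k) = begin
  sf (1 + 3 * suc k)              ≡⟨ cong (λ x → sf (1 + x)) (*-suc 3 k) ⟩
  sf (4 + 3 * k)                  ≡⟨ sf-3k+4 k ⟩
  sf (3 + 3 * k) + sf (1 + 3 * k) ≡⟨ cong (sf (3 + 3 * k) +_) (sf-3k+1≡sf-3k+2 k) ⟩
  sf (3 + 3 * k) + sf (2 + 3 * k) ≡⟨ sf-3k+5 k ⟨
  sf (5 + 3 * k)                  ≡⟨ cong (λ x → sf (2 + x)) (*-suc 3 k) ⟨
  sf (2 + 3 * suc k)              ∎
  where open ≡-Reasoning

sf-3k+4≡sf-3k+5 : ∀ k → sf (4 + 3 * k) ≡ sf (5 + 3 * k)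
sf-3k+4≡sf-3k+5 k = subst (λ x → sf (1 + x) ≡ sf (2 + x)) (*-suc 3 k) (sf-3k+1≡sf-3k+2 (suc k))

sf-3k+1≡sumTo : ∀ k → sf (1 + 3 * k) ≡ sumTo sf k
sf-3k+1≡sumTo zero    = refl
sf-3k+1≡sumTo (suc k) = begin
  sf (1 + 3 * suc k)              ≡⟨ cong (λ x → sf (1 + x)) (*-suc 3 k) ⟩
  sf (4 + 3 * k)                  ≡⟨ sf-3k+4 k ⟩
  sf (3 + 3 * k) + sf (1 + 3 * k) ≡⟨ cong₂ _+_ (sf-3k+3 k) (sf-3k+1≡sumTo k) ⟩
  sf (1 + k) + sumTo sf k         ≡⟨ +-comm (sf (1 + k)) _ ⟩
  sumTo sf (suc k)                ∎
  where open ≡-Reasoning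

sf-3k+4≡sumTo : ∀ k → sf (4 + 3 * k) ≡ sumTo sf (suc k)
sf-3k+4≡sumTo k = subst (λ x → sf (1 + x) ≡ sumTo sf (suc k)) (*-suc 3 k) (sf-3k+1≡sumTo (suc k))

sumTo-4+3k : ∀ k → sumTo sf (4 + 3 * k) ≡ sumTo sf (1 + 3 * k) + 2 * sf (4 + 3 * k)
sumTo-4+3k k = begin
  S (1 + 3 * k) + sf (2 + 3 * k) + sf (3 + 3 * k) + sf (4 + 3 * k)
    ≡⟨ cong₂ (λ a b → S (1 + 3 * k) + a + sf (3 + 3 * k) + b)
             (sym (sf-3k+1≡sf-3k+2 k)) (sf-3k+4 k) ⟩
  S (1 + 3 * k) + sf (1 + 3 * k) + sf (3 + 3 * k) + (sf (3 + 3 * k) + sf (1 + 3 * k))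
    ≡⟨ rearrange (S (1 + 3 * k)) (sf (1 + 3 * k)) (sf (3 + 3 * k)) ⟩
  S (1 + 3 * k) + 2 * (sf (3 + 3 * k) + sf (1 + 3 * k))
    ≡⟨ cong (λ a → S (1 + 3 * k) + 2 * a) (sf-3k+4 k) ⟨
  S (1 + 3 * k) + 2 * sf (4 + 3 * k) ∎
  where
  open ≡-Reasoning
  S : ℕ → ℕ
  S = sumTo sf
  rearrange : ∀ s a b → s + a + b + (b + a) ≡ s + 2 * (b + a)
  rearrange = solve-∀

sumTo-k+sumTo-3k : ∀ k → sumTo sf k + sumTo sf (3 * k) ≡ sumTo sf (1 + 3 * k)
sumTo-k+sumTo-3k k = begin
  sumTo sf k + sumTo sf (3 * k)     ≡⟨ +-comm (sumTo sf k) _ ⟩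
  sumTo sf (3 * k) + sumTo sf k     ≡⟨ cong (sumTo sf (3 * k) +_) (sf-3k+1≡sumTo k) ⟨
  sumTo sf (3 * k) + sf (1 + 3 * k) ∎
  where open ≡-Reasoning

sumTo-2+3k : ∀ k → sumTo sf (2 + 3 * k) ≡ sumTo sf (1 + 3 * k) + sumTo sf k
sumTo-2+3k k = cong (sumTo sf (1 + 3 * k) +_) (trans (sym (sf-3k+1≡sf-3k+2 k)) (sf-3k+1≡sumTo k))

2∣sumTo-1+3k : ∀ k → 2 ∣ sumTo sf (1 + 3 * k)
2∣sumTo-1+3k zero    = divides 1 refl
2∣sumTo-1+3k (suc k) = subst (λ x → 2 ∣ sumTo sf (1 + x)) (sym (*-suc 3 k))
  (subst (2 ∣_) (sym (sumTo-4+3k k)) (∣m∣n⇒∣m+n (2∣sumTo-1+3k k) (m∣m*n (sf (4 + 3 * k)))))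

data Mod3View : ℕ → Set where
  3k   : ∀ k → Mod3View (3 * k)
  1+3k : ∀ k → Mod3View (1 + 3 * k)
  2+3k : ∀ k → Mod3View (2 + 3 * k)

mod3View : ∀ n → Mod3View n
mod3View zero = 3k 0
mod3View (suc n) with mod3View n
... | 3k k   = 1+3k k
... | 1+3k k = 2+3k k
... | 2+3k k = subst Mod3View (*-suc 3 k) (3k (suc k))

∤m*n⇒∤n : ∀ m {d n} → ¬ d ∣ m * n → ¬ d ∣ n
∤m*n⇒∤n m d∤m*n d∣n = d∤m*n (∣-trans d∣n (n∣m*n m))

∤d+n⇒∤n : ∀ {d n} → ¬ d ∣ d + n → ¬ d ∣ n
∤d+n⇒∤n d∤d+n d∣n = d∤d+n (∣m∣n⇒∣m+n ∣-refl d∣n)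

2∣sumTo-odd : ∀ n → ¬ 2 ∣ n → 2 ∣ sumTo sf n
2∣sumTo-odd = <-rec _ λ n rec → go n (mod3View n) rec
  where
  go : ∀ n → Mod3View n → (∀ {m} → m < n → ¬ 2 ∣ m → 2 ∣ sumTo sf m) → ¬ 2 ∣ n → 2 ∣ sumTo sf n
  go _ (3k zero)    _   odd = contradiction (2 ∣0) odd
  go _ (3k (suc k)) rec odd = ∣m+n∣m⇒∣n
    (subst (2 ∣_) (sym (sumTo-k+sumTo-3k (suc k))) (2∣sumTo-1+3k (suc k)))
    (rec (m<m+n (suc k) (s≤s z≤n)) (∤m*n⇒∤n 3 odd))
  go _ (1+3k k) _   _   = 2∣sumTo-1+3k k
  go _ (2+3k k) rec odd = subst (2 ∣_) (sym (sumTo-2+3k k)) (∣m∣n⇒∣m+n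
    (2∣sumTo-1+3k k)
    (rec (s≤s (≤-trans (m≤n*m k 3) (n≤1+n _))) (∤m*n⇒∤n 3 (∤d+n⇒∤n odd))))

2∣n⇒2∤1+n : ∀ {n} → 2 ∣ n → ¬ 2 ∣ suc n
2∣n⇒2∤1+n {n} 2∣n 2∣1+n with ∣1⇒≡1 (∣m+n∣m⇒∣n (subst (2 ∣_) (+-comm 1 n) 2∣1+n) 2∣n)
... | ()

sf-3k+4≡sf-3k+5-even : ∀ k → 2 ∣ sumTo sf (suc k) →
                       (sf (3 * k + 4) ≡ sf (3 * k + 5)) × (2 ∣ sf (3 * k + 4))
sf-3k+4≡sf-3k+5-even k 2∣S rewrite +-comm (3 * k) 4 | +-comm (3 * k) 5 =
  sf-3k+4≡sf-3k+5 k , subst (2 ∣_) (sym (sf-3k+4≡sumTo k)) 2∣S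

theorem6 :
      ((j : ℕ) → 2 ∣ sumTo sf (2 * j + 1))
    × ((j : ℕ) → 2 ∣ j → (sf (3 * j + 4) ≡ sf (3 * j + 5)) × (2 ∣ sf (3 * j + 4)))
    × ((j r : ℕ) → r ≥ 2 → (sf (3 ^ r * j + 4) ≡ sf (3 ^ r * j + 5)) × (2 ∣ sf (3 ^ r * j + 4)))
theorem6 = part-a , part-b , part-c
  where
  part-a : (j : ℕ) → 2 ∣ sumTo sf (2 * j + 1)
  part-a j rewrite +-comm (2 * j) 1 = 2∣sumTo-odd (suc (2 * j)) (2∣n⇒2∤1+n (m∣m*n j))

  part-b : (j : ℕ) → 2 ∣ j → (sf (3 * j + 4) ≡ sf (3 * j + 5)) × (2 ∣ sf (3 * j + 4))
  part-b j 2∣j = sf-3k+4≡sf-3k+5-even j (2∣sumTo-odd (suc j) (2∣n⇒2∤1+n 2∣j))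

  part-c : (j r : ℕ) → r ≥ 2 → (sf (3 ^ r * j + 4) ≡ sf (3 ^ r * j + 5)) × (2 ∣ sf (3 ^ r * j + 4))
  part-c j 1 (s≤s ())
  part-c j (suc (suc r)) _ rewrite *-assoc 3 (3 * 3 ^ r) j | *-assoc 3 (3 ^ r) j =
    sf-3k+4≡sf-3k+5-even (3 * (3 ^ r * j)) (2∣sumTo-1+3k (3 ^ r * j))
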